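{- Let $G$ be a connected graph of order $n\ge 2$ with $V(G)=\{u_1,\ldots,u_n\}$, let $\mathcal{H}=\{H_1,\ldots,H_n\}$ be a family of $n$ non-trivial graphs, and let $k\in\{1,\ldots,\min\{\mathcal{T}(G\circ\mathcal{H}),\mathcal{C}(\mathcal{H})\}\}$. (i) If $(G,\mathcal{H},k)$ satisfies Properties $\mathcal{P}_1$ and $\mathcal{P}_2$, then $\dim_k(G\circ\mathcal{H})=\sum_{i=1}^n\operatorname{adim}_k(H_i)$. (ii) If $(G,\mathcal{H},k)$ satisfies Properties $\mathcal{P}_3$ and $\mathcal{P}_4$, then $\dim_k(G\circ\overline{\mathcal{H}})=\sum_{i=1}^n\operatorname{adim}_k(H_i)$, where $\overline{\mathcal{H}}=\{\overline{H}_1,\ldots,\overline{H}_n\}$.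
   Context: Graphs are finite and simple; non-trivial means at least two vertices; $\delta,\Delta$ are minimum/maximum degree. Lexicographic product $G\circ\mathcal{H}$: vertex set $\bigcup_i\{u_i\}\times V(H_i)$, with $(u_i,v)\sim(u_j,w)$ iff $u_iu_j\in E(G)$, or $i=j$ and $vw\in E(H_i)$. For connected $X$, $S\subseteq V(X)$ is a $k$-metric generator if every two distinct vertices $x,y$ admit at least $k$ vertices $w\in S$ with $d_X(x,w)\neq d_X(y,w)$; $\dim_k(X)$ is its minimum cardinality. For a graph $H$, $S$ is a $k$-adjacency generator if every two distinct $x,y$ satisfy $|((N_H(x)\triangledown N_H(y))\cup\{x,y\})\cap S|\ge k$; $\operatorname{adim}_k(H)$ is its minimum cardinality and a $k$-adjacency basis is one of that cardinality. $\mathcal{C}(H)=\min_{x\neq y}|(N_H(x)\triangledown N_H(y))\cup\{x,y\}|$, $\mathcal{C}(\mathcal{H})=\min_i\mathcal{C}(H_i)$. Twins in $G$: distinct $x,y$ are true twins if $N[x]=N[y]$, false twins if $N(x)=N(y)$; the relation $N(x)-\{y\}=N(y)-\{x\}$ partitions $V(G)$ into singleton, false twin and true twin classes with unions $S(G),FT(G),TT(G)$; $FT(u_i)$, $TT(u_i)$ is the class of $u_i$. $\mathcal{T}(u_i,\mathcal{H})=|V(H_i)|$ if $u_i\in S(G)$; $=\min\{\delta(H_j)+\delta(H_l)+2: u_j,u_l\in FT(u_i), j\neq l\}$ if $u_i\in FT(G)$; $=\min\{|V(H_j)|-\Delta(H_j)+|V(H_l)|-\Delta(H_l): u_j,u_l\in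 TT(u_i), j\neq l\}$ if $u_i\in TT(G)$; $\mathcal{T}(G\circ\mathcal{H})=\min_{u_i}\mathcal{T}(u_i,\mathcal{H})$. Properties of $(G,\mathcal{H},k)$: $\mathcal{P}_1$: for every $u_i\in TT(G)$ with $TT(u_i)=\{u_{i_1},\ldots,u_{i_r}\}$ there exist $k$-adjacency bases $A_{i_1},\ldots,A_{i_r}$ of $H_{i_1},\ldots,H_{i_r}$ such that for all $j\neq l$, all $x\in V(H_{i_j})$, $y\in V(H_{i_l})$: $|(A_{i_j}\cap(V(H_{i_j})-N_{H_{i_j}}(x)))\cup(A_{i_l}\cap(V(H_{i_l})-N_{H_{i_l}}(y)))|\ge k$. $\mathcal{P}_2$: for every $u_i\in FT(G)$ with $FT(u_i)=\{u_{i_1},\ldots,u_{i_r}\}$, there exist such bases with $|(A_{i_j}\cap N_{H_{i_j}}[x])\cup(A_{i_l}\cap N_{H_{i_l}}[y])|\ge k$. $\mathcal{P}_3$: as $\mathcal{P}_1$ (over $TT(G)$) with $|(A_{i_j}\cap N_{H_{i_j}}(x))\cup(A_{i_l}\cap N_{H_{i_l}}(y))|\ge k$. $\mathcal{P}_4$: as $\mathcal{P}_2$ (over $FT(G)$) with $|(A_{i_j}\cap(V(H_{i_j})-N_{H_{i_j}}(x)))\cup(A_{i_l}\cap(V(H_{i_l})-N_{H_{i_l}}(y)))|\ge k$. -}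

module Defs where

open import Data.Nat using (ℕ; zero; suc; _+_; _∸_; _≤_; _⊓_; _⊔_; _≡ᵇ_)
open import Data.Bool using (Bool; true; false; _∧_; _∨_; not; _xor_; if_then_else_)
open import Data.Fin using (Fin; zero; suc; splitAt; _≟_)
open import Data.Fin.Properties using ()
open import Data.List using (List; foldr; allFin)
open import Data.Sum using (inj₁; inj₂)
open import Data.Product using (Σ; ∃; _×_; _,_; proj₁; proj₂)
open import Relation.Binary.PropositionalEquality using (_≡_; _≢_; refl)
open import Relation.Nullary using (yes; no)
open import Relation.Nullary.Decidable using (⌊_⌋)

record Graph : Set where
  constructor mkGraph
  field
    size : ℕ
    adj  : Fin size → Fin size → Bool
open Graph public

IsSimple : Graph → Set
IsSimple H = (∀ x y → adj H x y ≡ adj H y x) × (∀ x → adj H x x ≡ false)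

_==_ : ∀ {n} → Fin n → Fin n → Bool
x == y = ⌊ x ≟ y ⌋

count : ∀ {n} → (Fin n → Bool) → ℕ
count {zero}  p = 0
count {suc n} p = (if p zero then 1 else 0) + count (λ i → p (suc i))

anyF : ∀ {n} → (Fin n → Bool) → Bool
anyF {zero}  p = false
anyF {suc n} p = p zero ∨ anyF (λ i → p (suc i))

sumF : ∀ {n} → (Fin n → ℕ) → ℕ
sumF {zero}  f = 0
sumF {suc n} f = f zero + sumF (λ i → f (suc i))

maxF : ∀ {n} → (Fin n → ℕ) → ℕ
maxF {n} f = foldr (λ i acc → f i ⊔ acc) 0 (allFin n)

-- minimum of f over a non-empty Fin n (0 on the empty type)
minF : ∀ {n} → (Fin n → ℕ) → ℕ
minF {zero}  f = 0
minF {suc n} f = foldr (λ i acc → f i ⊓ acc) (f zero) (allFin (suc n))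

Subset : ℕ → Set
Subset n = Fin n → Bool

deg : (H : Graph) → Fin (size H) → ℕ
deg H x = count (adj H x)

δ : Graph → ℕ
δ H = minF (deg H)

Δ : Graph → ℕ
Δ H = maxF (deg H)

reach : (H : Graph) → ℕ → Fin (size H) → Fin (size H) → Bool
reach H zero    x y = x == y
reach H (suc m) x y = reach H m x y ∨ anyF (λ z → reach H m x z ∧ adj H z y)

Connected : Graph → Set
Connected H = ∀ x y → ∃ λ m → reach H m x y ≡ true

search : (ℕ → Bool) → ℕ → ℕ → ℕ
search f m zero       = m
search f m (suc fuel) = if f m then m else search f (suc m) fuel

-- shortest-path distance d_H(x,y) (correct for connected H,
-- since then every distance is < size H)
dist : (H : Graph) → Fin (size H) → Fin (size H) → ℕ
dist H x y = search (λ m → reach H m x y) 0 (size H)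

IsBasis : ∀ {n} → (Subset n → Set) → Subset n → Set
IsBasis P A = P A × (∀ S → P S → count A ≤ count S)

IsMinCard : ∀ {n} → (Subset n → Set) → ℕ → Set
IsMinCard P m = (∃ λ S → P S × count S ≡ m) × (∀ S → P S → m ≤ count S)

IsKMetricGen : (X : Graph) → ℕ → Subset (size X) → Set
IsKMetricGen X k S = ∀ x y → x ≢ y →
  k ≤ count (λ w → S w ∧ not (dist X x w ≡ᵇ dist X y w))

IsDimK : (X : Graph) → ℕ → ℕ → Set
IsDimK X k m = IsMinCard (IsKMetricGen X k) m

adjDistinguishers : (H : Graph) → Fin (size H) → Fin (size H) → Subset (size H)
adjDistinguishers H x y w = (adj H x w xor adj H y w) ∨ (w == x) ∨ (w == y)

IsKAdjGen : (H : Graph) → ℕ → Subset (size H) → Set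
IsKAdjGen H k S = ∀ x y → x ≢ y →
  k ≤ count (λ w → S w ∧ adjDistinguishers H x y w)

IsAdimK : (H : Graph) → ℕ → ℕ → Set
IsAdimK H k m = IsMinCard (IsKAdjGen H k) m

IsKAdjBasis : (H : Graph) → ℕ → Subset (size H) → Set
IsKAdjBasis H k A = IsBasis (IsKAdjGen H k) A

LeC : ℕ → Graph → Set
LeC k H = ∀ x y → x ≢ y → k ≤ count (adjDistinguishers H x y)

complement : Graph → Graph
complement H = mkGraph (size H) (λ x y → not (adj H x y) ∧ not (x == y))

-- Lexicographic product G ∘ H, H a family indexed by V(G) = Fin n.
-- Vertex set: Fin (Σ_i |V(H_i)|), identified with the pairs (u_i , v)
-- via the block decomposition `split`.

sizes : ∀ {n} → (Fin n → Graph) → Fin n → ℕ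
sizes H i = size (H i)

split : ∀ {n} (s : Fin n → ℕ) → Fin (sumF s) → Σ (Fin n) (λ i → Fin (s i))
split {suc n} s x with splitAt (s zero) x
... | inj₁ v = zero , v
... | inj₂ w with split (λ i → s (suc i)) w
...   | (i , v) = suc i , v

sameBlockAdj : ∀ {n} (H : Fin n → Graph) (i j : Fin n) →
               Fin (size (H i)) → Fin (size (H j)) → Bool
sameBlockAdj H i j v w with i ≟ j
... | yes refl = adj (H i) v w
... | no _     = false

lex : (G : Graph) → (Fin (size G) → Graph) → Graph
lex G H = mkGraph (sumF (sizes H)) λ x y →
  let p = split (sizes H) x
      q = split (sizes H) y
  in adj G (proj₁ p) (proj₁ q) ∨ sameBlockAdj H (proj₁ p) (proj₁ q) (proj₂ p) (proj₂ q)

twin : (G : Graph) → Fin (size G) → Fin (size G) → Bool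
twin G x y = not (anyF (λ z → not (z == x) ∧ not (z == y) ∧ (adj G x z xor adj G y z)))

InClass : (G : Graph) → Fin (size G) → Fin (size G) → Set
InClass G i j = twin G i j ≡ true

InS : (G : Graph) → Fin (size G) → Set
InS G i = ∀ j → j ≢ i → twin G i j ≡ false

InFT : (G : Graph) → Fin (size G) → Set
InFT G i = ∃ λ j → j ≢ i × twin G i j ≡ true × adj G i j ≡ false

InTT : (G : Graph) → Fin (size G) → Set
InTT G i = ∃ λ j → j ≢ i × twin G i j ≡ true × adj G i j ≡ true

-- k ≤ T(G ∘ H)  (T is the minimum over u_i of T(u_i,H); for FT/TT
-- vertices T(u_i,H) is itself a minimum over pairs in the class)

LeT : ℕ → (G : Graph) → (Fin (size G) → Graph) → Set
LeT k G H = ∀ i →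
    (InS G i → k ≤ size (H i))
  × (InFT G i → ∀ j l → InClass G i j → InClass G i l → j ≢ l →
       k ≤ δ (H j) + δ (H l) + 2)
  × (InTT G i → ∀ j l → InClass G i j → InClass G i l → j ≢ l →
       k ≤ (size (H j) ∸ Δ (H j)) + (size (H l) ∸ Δ (H l)))

-- generic shape: for every u_i in the given kind of class there exist
-- k-adjacency bases A_j of H_j (for u_j in the class of u_i) such that
-- for distinct u_j,u_l in the class and x ∈ V(H_j), y ∈ V(H_l),
-- |(A_j ∩ F_j(x)) ∪ (A_l ∩ F_l(y))| ≥ k  (disjoint union, so a sum).
PropertyShape : (G : Graph) → (Fin (size G) → Graph) → ℕ →
  (Fin (size G) → Set) →
  ((K : Graph) → Fin (size K) → Subset (size K)) → Set
PropertyShape G H k Kind F = ∀ i → Kind i →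
  ∃ λ (A : (j : Fin (size G)) → Subset (size (H j))) →
      (∀ j → InClass G i j → IsKAdjBasis (H j) k (A j))
    × (∀ j l → InClass G i j → InClass G i l → j ≢ l →
         ∀ (x : Fin (size (H j))) (y : Fin (size (H l))) →
         k ≤ count (λ v → A j v ∧ F (H j) x v) + count (λ w → A l w ∧ F (H l) y w))

nonNbr : (K : Graph) → Fin (size K) → Subset (size K)
nonNbr K x v = not (adj K x v)

closedNbr : (K : Graph) → Fin (size K) → Subset (size K)
closedNbr K x v = adj K x v ∨ (v == x)

openNbr : (K : Graph) → Fin (size K) → Subset (size K)
openNbr K x v = adj K x v

P₁ P₂ P₃ P₄ : (G : Graph) → (Fin (size G) → Graph) → ℕ → Set
P₁ G H k = PropertyShape G H k (InTT G) nonNbr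
P₂ G H k = PropertyShape G H k (InFT G) closedNbr
P₃ G H k = PropertyShape G H k (InTT G) openNbr
P₄ G H k = PropertyShape G H k (InFT G) nonNbr

-- A k-metric generator S of G ∘ H restricts to a k-adjacency generator of every H_i: a vertex resolving
-- (u_i, v) and (u_i, v′) must be a vertex (u_i, z) with z ∈ (N(v) ▽ N(v′)) ∪ {v, v′}, since
-- vertices of other copies are equally far from both, and inside the copy distances are 1 or 2 (a
-- neighbouring copy, which exists as G is connected, provides common neighbours). This gives
-- dim_k ≥ Σ adim_k. Conversely, in any graph a vertex of (N(x) ▽ N(y)) ∪ {x, y} resolves x and y, so it
-- suffices that the union of k-adjacency bases B_i be a k-adjacency generator of G ∘ H. Two vertices of
-- one copy are separated by B_i; vertices in copies of non-twins u_i, u_j by the whole B_l of a vertex u_l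
-- adjacent to exactly one of u_i, u_j; for copies of true (false) twins the vertices of B_i and B_j that
-- separate (u_i, v) from (u_j, w) are exactly those counted in P₁ (P₂), provided the bases are chosen
-- once per twin class. Part (ii) is part (i) for the complements: H and its complement have the same
-- adjacency generators, and P₃, P₄ for H imply P₁, P₂ for the complements.

module Submission where

open import Defs
open import Data.Nat using (ℕ; zero; suc; _+_; _≤_; _<_; z≤n; s≤s; s<s⁻¹; _≡ᵇ_)
open import Data.Nat.Properties
  using (≤-refl; ≤-trans; ≤-reflexive; ≤-antisym; +-mono-≤; +-comm; +-assoc; +-identityʳ; m≤m+n; m≤n+m;
         module ≤-Reasoning)
open import Data.Bool using (Bool; true; false; _∧_; _∨_; not; _xor_; if_then_else_)
open import Data.Bool.Properties
  using (∧-zeroʳ; ∧-identityʳ; ∨-zeroʳ; ∨-identityʳ; ∨-comm; xor-comm; xor-same; xor-annihilates-not; not-¬)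
  renaming (_≟_ to _≟ᵇ_)
open import Data.Fin using (Fin; zero; suc; splitAt; _↑ˡ_; _↑ʳ_; _≟_)
open import Data.Fin.Properties using (splitAt-↑ˡ; splitAt-↑ʳ; join-splitAt; suc-injective; any?)
open import Data.Maybe using (Maybe; just; nothing; fromMaybe) renaming (map to mapMaybe)
open import Data.Sum using (inj₁; inj₂; _⊎_)
open import Data.Product using (Σ; ∃; _×_; _,_; proj₁; proj₂)
open import Function using (_∘_)
open import Relation.Binary.PropositionalEquality
  using (_≡_; _≢_; ≢-sym; refl; sym; trans; cong; cong₂; subst; subst₂; module ≡-Reasoning)
open import Relation.Nullary using (Dec; yes; no; ¬?; _×-dec_; contradiction)

-- Booleans and counting over Fin

∧-introᵇ : ∀ {a b} → a ≡ true → b ≡ true → a ∧ b ≡ true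
∧-introᵇ refl refl = refl

∧-projˡ : ∀ {a b} → a ∧ b ≡ true → a ≡ true
∧-projˡ {true} _ = refl

∧-projʳ : ∀ {a b} → a ∧ b ≡ true → b ≡ true
∧-projʳ {true} e = e

∧-monoʳ : ∀ {a b c} → (b ≡ true → c ≡ true) → a ∧ b ≡ true → a ∧ c ≡ true
∧-monoʳ f e = ∧-introᵇ (∧-projˡ e) (f (∧-projʳ e))

∨-injˡ : ∀ {a b} → a ≡ true → a ∨ b ≡ true
∨-injˡ refl = refl

∨-injʳ : ∀ {a b} → b ≡ true → a ∨ b ≡ true
∨-injʳ {true} _ = refl
∨-injʳ {false} e = e

∨-cases : ∀ {a b} → a ∨ b ≡ true → a ≡ true ⊎ b ≡ true
∨-cases {true} _ = inj₁ refl
∨-cases {false} e = inj₂ e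

not-true : ∀ {a} → not a ≡ true → a ≡ false
not-true {false} _ = refl

not-false : ∀ {a} → not a ≡ false → a ≡ true
not-false {true} _ = refl

xor-true : ∀ {a b} → a ≢ b → a xor b ≡ true
xor-true {true} {true} ne = contradiction refl ne
xor-true {true} {false} _ = refl
xor-true {false} {true} _ = refl
xor-true {false} {false} ne = contradiction refl ne

xor-true⇒≢ : ∀ {a b} → a xor b ≡ true → a ≢ b
xor-true⇒≢ {true} {true} ()
xor-true⇒≢ {false} {false} ()

xor-false : ∀ {a b} → a xor b ≡ false → a ≡ b
xor-false {true} {true} _ = refl
xor-false {false} {false} _ = refl

≡true-ext : ∀ {a b} → (a ≡ true → b ≡ true) → (b ≡ true → a ≡ true) → a ≡ b
≡true-ext {true} a⇒b _ = sym (a⇒b refl)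
≡true-ext {false} {true} _ b⇒a = b⇒a refl
≡true-ext {false} {false} _ _ = refl

true≢false : true ≢ false
true≢false ()

==-refl : ∀ {n} (x : Fin n) → (x == x) ≡ true
==-refl x with x ≟ x
... | yes _ = refl
... | no x≢x = contradiction refl x≢x

==-false : ∀ {n} {x y : Fin n} → x ≢ y → (x == y) ≡ false
==-false {x = x} {y} x≢y with x ≟ y
... | yes x≡y = contradiction x≡y x≢y
... | no _ = refl

==⇒≡ : ∀ {n} {x y : Fin n} → (x == y) ≡ true → x ≡ y
==⇒≡ {x = x} {y} e with x ≟ y
... | yes p = p

==-sym : ∀ {n} (x y : Fin n) → (x == y) ≡ (y == x)
==-sym x y with x ≟ y
... | yes refl = sym (==-refl x)
... | no x≢y = sym (==-false (x≢y ∘ sym))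

distinctPair : ∀ {n} → 2 ≤ n → Σ (Fin n) λ a → Σ (Fin n) λ b → a ≢ b
distinctPair (s≤s (s≤s _)) = zero , suc zero , λ ()

count-mono : ∀ {n} (p q : Fin n → Bool) → (∀ x → p x ≡ true → q x ≡ true) → count p ≤ count q
count-mono {zero} p q p⊆q = z≤n
count-mono {suc n} p q p⊆q with p zero in p₀ | q zero in q₀
... | true  | true  = s≤s (count-mono _ _ (p⊆q ∘ suc))
... | false | false = count-mono _ _ (p⊆q ∘ suc)
... | false | true  = ≤-trans (count-mono _ _ (p⊆q ∘ suc)) (m≤n+m _ 1)
... | true  | false = contradiction (trans (sym (p⊆q zero p₀)) q₀) true≢false

count-∧≤ : ∀ {n} (p q : Fin n → Bool) → count (λ x → p x ∧ q x) ≤ count p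
count-∧≤ p q = count-mono _ p λ x → ∧-projˡ {p x}

count-none : ∀ {n} (p : Fin n → Bool) → (∀ x → p x ≡ false) → count p ≡ 0
count-none {zero} p none = refl
count-none {suc n} p none rewrite none zero = count-none _ (none ∘ suc)

count-cong : ∀ {n} (p q : Fin n → Bool) → (∀ x → p x ≡ q x) → count p ≡ count q
count-cong {zero} p q p≗q = refl
count-cong {suc n} p q p≗q rewrite p≗q zero = cong (_ +_) (count-cong _ _ (p≗q ∘ suc))

count-++ : ∀ m n (p : Fin (m + n) → Bool) →
  count p ≡ count (λ i → p (i ↑ˡ n)) + count (λ i → p (m ↑ʳ i))
count-++ zero n p = refl
count-++ (suc m) n p rewrite count-++ m n (p ∘ suc) = sym (+-assoc (if p zero then 1 else 0) _ _)

anyF-intro : ∀ {n} (p : Fin n → Bool) z → p z ≡ true → anyF p ≡ true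
anyF-intro p zero pz rewrite pz = refl
anyF-intro p (suc z) pz = ∨-injʳ (anyF-intro (p ∘ suc) z pz)

anyF-witness : ∀ {n} (p : Fin n → Bool) → anyF p ≡ true → ∃ λ z → p z ≡ true
anyF-witness {suc n} p some with p zero in p₀
... | true = zero , p₀
... | false with anyF-witness (p ∘ suc) some
...   | z , pz = suc z , pz

anyF-false : ∀ {n} (p : Fin n → Bool) → anyF p ≡ false → ∀ z → p z ≡ false
anyF-false p none z with p z in pz
... | false = refl
... | true = trans (sym (anyF-intro p z pz)) none

anyF-none : ∀ {n} (p : Fin n → Bool) → (∀ z → p z ≡ false) → anyF p ≡ false
anyF-none {zero} p none = refl
anyF-none {suc n} p none rewrite none zero = anyF-none (p ∘ suc) (none ∘ suc)

sumF-cong : ∀ {n} (f g : Fin n → ℕ) → (∀ i → f i ≡ g i) → sumF f ≡ sumF g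
sumF-cong {zero} f g f≗g = refl
sumF-cong {suc n} f g f≗g = cong₂ _+_ (f≗g zero) (sumF-cong _ _ (f≗g ∘ suc))

sumF-mono : ∀ {n} (f g : Fin n → ℕ) → (∀ i → f i ≤ g i) → sumF f ≤ sumF g
sumF-mono {zero} f g f≤g = z≤n
sumF-mono {suc n} f g f≤g = +-mono-≤ (f≤g zero) (sumF-mono _ _ (f≤g ∘ suc))

term≤sumF : ∀ {n} (f : Fin n → ℕ) i → f i ≤ sumF f
term≤sumF f zero = m≤m+n _ _
term≤sumF f (suc i) = ≤-trans (term≤sumF (f ∘ suc) i) (m≤n+m _ _)

twoTerms≤sumF : ∀ {n} (f : Fin n → ℕ) i j → i ≢ j → f i + f j ≤ sumF f
twoTerms≤sumF f zero zero i≢j = contradiction refl i≢j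
twoTerms≤sumF f zero (suc j) _ = +-mono-≤ ≤-refl (term≤sumF (f ∘ suc) j)
twoTerms≤sumF f (suc i) zero _ =
  subst (_≤ sumF f) (+-comm (f zero) (f (suc i))) (+-mono-≤ ≤-refl (term≤sumF (f ∘ suc) i))
twoTerms≤sumF f (suc i) (suc j) i≢j =
  ≤-trans (twoTerms≤sumF (f ∘ suc) i j (i≢j ∘ cong suc)) (m≤n+m _ _)

sumF-zero : ∀ n → sumF {n} (λ _ → 0) ≡ 0
sumF-zero zero = refl
sumF-zero (suc n) = sumF-zero n

sumF-single : ∀ {n} (f : Fin n → ℕ) i → (∀ j → j ≢ i → f j ≡ 0) → sumF f ≡ f i
sumF-single {suc n} f zero others
  rewrite sumF-cong (f ∘ suc) (λ _ → 0) (λ j → others (suc j) (λ ())) | sumF-zero n = +-identityʳ (f zero)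
sumF-single {suc n} f (suc i) others
  rewrite others zero (λ ()) = sumF-single (f ∘ suc) i (λ j j≢i → others (suc j) (j≢i ∘ suc-injective))

unsplit : ∀ {n} (s : Fin n → ℕ) (i : Fin n) → Fin (s i) → Fin (sumF s)
unsplit {suc n} s zero v = v ↑ˡ sumF (s ∘ suc)
unsplit {suc n} s (suc i) v = s zero ↑ʳ unsplit (s ∘ suc) i v

split-unsplit : ∀ {n} (s : Fin n → ℕ) i v → split s (unsplit s i v) ≡ (i , v)
split-unsplit {suc n} s zero v rewrite splitAt-↑ˡ (s zero) v (sumF (s ∘ suc)) = refl
split-unsplit {suc n} s (suc i) v
  rewrite splitAt-↑ʳ (s zero) (sumF (s ∘ suc)) (unsplit (s ∘ suc) i v)
        | split-unsplit (s ∘ suc) i v = refl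

unsplit-split : ∀ {n} (s : Fin n → ℕ) x → unsplit s (proj₁ (split s x)) (proj₂ (split s x)) ≡ x
unsplit-split {suc n} s x with splitAt (s zero) x | join-splitAt (s zero) (sumF (s ∘ suc)) x
... | inj₁ v | joined = joined
... | inj₂ w | joined with split (s ∘ suc) w | unsplit-split (s ∘ suc) w
...   | (i , v) | ih = trans (cong (s zero ↑ʳ_) ih) joined

unsplit-injectiveʳ : ∀ {n} (s : Fin n → ℕ) {i v w} → unsplit s i v ≡ unsplit s i w → v ≡ w
unsplit-injectiveʳ s {i} {v} {w} e
  with trans (sym (split-unsplit s i v)) (trans (cong (split s) e) (split-unsplit s i w))
... | refl = refl

count-blocks : ∀ {n} (s : Fin n → ℕ) (p : Fin (sumF s) → Bool) →
  count p ≡ sumF (λ l → count (p ∘ unsplit s l))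
count-blocks {zero} s p = refl
count-blocks {suc n} s p rewrite count-++ (s zero) (sumF (s ∘ suc)) p =
  cong (count (λ v → p (v ↑ˡ sumF (s ∘ suc))) +_) (count-blocks (s ∘ suc) (λ w → p (s zero ↑ʳ w)))

count-oneBlock : ∀ {n} (s : Fin n → ℕ) (p : Fin (sumF s) → Bool) i (q : Fin (s i) → Bool) →
  (∀ z → q z ≡ true → p (unsplit s i z) ≡ true) → count q ≤ count p
count-oneBlock s p i q q⊆p = begin
  count q                                   ≤⟨ count-mono q _ q⊆p ⟩
  count (p ∘ unsplit s i)                   ≤⟨ term≤sumF (λ l → count (p ∘ unsplit s l)) i ⟩
  sumF (λ l → count (p ∘ unsplit s l))      ≡⟨ count-blocks s p ⟨
  count p                                   ∎
  where open ≤-Reasoning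

count-twoBlocks : ∀ {n} (s : Fin n → ℕ) (p : Fin (sumF s) → Bool) {i j} → i ≢ j →
  (q : Fin (s i) → Bool) (r : Fin (s j) → Bool) →
  (∀ z → q z ≡ true → p (unsplit s i z) ≡ true) → (∀ z → r z ≡ true → p (unsplit s j z) ≡ true) →
  count q + count r ≤ count p
count-twoBlocks s p {i} {j} i≢j q r q⊆p r⊆p = begin
  count q + count r
    ≤⟨ +-mono-≤ (count-mono q _ q⊆p) (count-mono r _ r⊆p) ⟩
  count (p ∘ unsplit s i) + count (p ∘ unsplit s j)
    ≤⟨ twoTerms≤sumF (λ l → count (p ∘ unsplit s l)) i j i≢j ⟩
  sumF (λ l → count (p ∘ unsplit s l))
    ≡⟨ count-blocks s p ⟨
  count p ∎
  where open ≤-Reasoning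

count-withinBlock : ∀ {n} (s : Fin n → ℕ) (p : Fin (sumF s) → Bool) i →
  (∀ l → l ≢ i → ∀ z → p (unsplit s l z) ≡ false) → count p ≡ count (p ∘ unsplit s i)
count-withinBlock s p i outside = trans (count-blocks s p)
  (sumF-single (λ l → count (p ∘ unsplit s l)) i λ l l≢i → count-none _ (outside l l≢i))

first : ∀ {n} → (Fin n → Bool) → Maybe (Fin n)
first {zero} p = nothing
first {suc n} p = if p zero then just zero else mapMaybe suc (first (p ∘ suc))

first-cong : ∀ {n} (p q : Fin n → Bool) → (∀ x → p x ≡ q x) → first p ≡ first q
first-cong {zero} p q p≗q = refl
first-cong {suc n} p q p≗q rewrite p≗q zero | first-cong (p ∘ suc) (q ∘ suc) (p≗q ∘ suc) = refl

first-found : ∀ {n} (p : Fin n → Bool) x → p x ≡ true → ∃ λ t → first p ≡ just t × p t ≡ true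
first-found {suc n} p x px with p zero in p₀
... | true = zero , refl , p₀
first-found {suc n} p zero px | false = contradiction (trans (sym px) p₀) true≢false
first-found {suc n} p (suc x) px | false with first-found (p ∘ suc) x px
... | t , found , pt rewrite found = suc t , refl , pt

choose : ∀ {n} → Fin n → (Fin n → Bool) → Fin n
choose d p = fromMaybe d (first p)

choose-satisfies : ∀ {n} d (p : Fin n → Bool) → p d ≡ true → p (choose d p) ≡ true
choose-satisfies d p pd with first-found p d pd
... | t , found , pt rewrite found = pt

choose-cong : ∀ {n} d e (p q : Fin n → Bool) → p d ≡ true → (∀ x → p x ≡ q x) → choose d p ≡ choose e q
choose-cong d e p q pd p≗q with first-found p d pd
... | t , found , _ rewrite found | trans (sym (first-cong p q p≗q)) found = refl

≢⇒not-≡ᵇ : ∀ {m n} → m ≢ n → not (m ≡ᵇ n) ≡ true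
≢⇒not-≡ᵇ {zero} {zero} m≢n = contradiction refl m≢n
≢⇒not-≡ᵇ {zero} {suc n} _ = refl
≢⇒not-≡ᵇ {suc m} {zero} _ = refl
≢⇒not-≡ᵇ {suc m} {suc n} m≢n = ≢⇒not-≡ᵇ (m≢n ∘ cong suc)

not-≡ᵇ-refl : ∀ m → not (m ≡ᵇ m) ≡ false
not-≡ᵇ-refl zero = refl
not-≡ᵇ-refl (suc m) = not-≡ᵇ-refl m

not-≡ᵇ⇒≢ : ∀ {m n} → not (m ≡ᵇ n) ≡ true → m ≢ n
not-≡ᵇ⇒≢ {suc m} {suc n} e refl = not-≡ᵇ⇒≢ {m} e refl

search-suc : ∀ (f : ℕ → Bool) s N → search f (suc s) N ≡ suc (search (f ∘ suc) s N)
search-suc f s zero = refl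
search-suc f s (suc N) with f (suc s)
... | true = refl
... | false = search-suc f (suc s) N

search-least : ∀ (f : ℕ → Bool) N t → t < N → f t ≡ true → (∀ m → m < t → f m ≡ false) →
  search f 0 N ≡ t
search-least f (suc N) zero _ ft _ rewrite ft = refl
search-least f (suc N) (suc t) (s≤s t<N) ft below rewrite below 0 (s≤s z≤n) =
  trans (search-suc f 0 N) (cong suc (search-least (f ∘ suc) N t t<N ft (λ m m<t → below (suc m) (s≤s m<t))))

search-found : ∀ (f : ℕ → Bool) N → search f 0 N < N → f (search f 0 N) ≡ true
search-found f (suc N) lt with f 0 in f₀
... | true = f₀
... | false rewrite search-suc f 0 N = search-found (f ∘ suc) N (s<s⁻¹ lt)

search-cong : ∀ (f g : ℕ → Bool) → (∀ m → f m ≡ g m) → ∀ s N → search f s N ≡ search g s N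
search-cong f g f≗g s zero = refl
search-cong f g f≗g s (suc N) rewrite f≗g s = cong (if g s then s else_) (search-cong f g f≗g (suc s) N)

-- Walks and distances

Loopless : Graph → Set
Loopless X = ∀ x → adj X x x ≡ false

module Distances (X : Graph) where

  reach-refl : ∀ m a → reach X m a a ≡ true
  reach-refl zero a = ==-refl a
  reach-refl (suc m) a = ∨-injˡ (reach-refl m a)

  reach-step : ∀ m a c b → reach X m a c ≡ true → adj X c b ≡ true → reach X (suc m) a b ≡ true
  reach-step m a c b ac cb = ∨-injʳ (anyF-intro _ c (∧-introᵇ ac cb))

  adj⇒reach₁ : ∀ a b → adj X a b ≡ true → reach X 1 a b ≡ true
  adj⇒reach₁ a b = reach-step 0 a a b (==-refl a)

  reach₁⇒ : ∀ a b → reach X 1 a b ≡ true → a ≡ b ⊎ adj X a b ≡ true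
  reach₁⇒ a b r with ∨-cases r
  ... | inj₁ a=b = inj₁ (==⇒≡ a=b)
  ... | inj₂ step with anyF-witness (λ c → reach X 0 a c ∧ adj X c b) step
  ...   | c , ac∧cb with ==⇒≡ {x = a} {c} (∧-projˡ ac∧cb)
  ...     | refl = inj₂ (∧-projʳ ac∧cb)

  reach₁-false : ∀ a b → a ≢ b → adj X a b ≡ false → reach X 1 a b ≡ false
  reach₁-false a b a≢b ab with reach X 1 a b in r
  ... | false = refl
  ... | true with reach₁⇒ a b r
  ...   | inj₁ a≡b = contradiction a≡b a≢b
  ...   | inj₂ ab′ = trans (sym ab′) ab

  reach⇒neighbour : ∀ m a b → reach X m a b ≡ true → a ≢ b → ∃ λ t → adj X a t ≡ true
  reach⇒neighbour zero a b r a≢b = contradiction (==⇒≡ r) a≢b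
  reach⇒neighbour (suc m) a b r a≢b with ∨-cases r
  ... | inj₁ r′ = reach⇒neighbour m a b r′ a≢b
  ... | inj₂ step with anyF-witness (λ c → reach X m a c ∧ adj X c b) step
  ...   | c , ac∧cb with a ≟ c
  ...     | yes refl = b , ∧-projʳ ac∧cb
  ...     | no a≢c = reach⇒neighbour m a c (∧-projˡ ac∧cb) a≢c

  dist-self : 1 ≤ size X → ∀ a → dist X a a ≡ 0
  dist-self pos a = search-least _ (size X) 0 pos (==-refl a) (λ _ ())

  reach-dist : ∀ a b t → dist X a b ≡ t → t < size X → reach X t a b ≡ true
  reach-dist a b t d≡t t<n =
    subst (λ u → reach X u a b ≡ true) d≡t (search-found _ (size X) (subst (_< size X) (sym d≡t) t<n))

  dist≡0⇒≡ : 1 ≤ size X → ∀ a b → dist X a b ≡ 0 → a ≡ b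
  dist≡0⇒≡ pos a b d≡0 = ==⇒≡ (reach-dist a b 0 d≡0 pos)

  adj⇒dist≡1 : 2 ≤ size X → ∀ a b → a ≢ b → adj X a b ≡ true → dist X a b ≡ 1
  adj⇒dist≡1 two a b a≢b ab = search-least _ (size X) 1 two (adj⇒reach₁ a b ab)
    λ { zero _ → ==-false a≢b ; (suc _) (s≤s ()) }

  dist≡1⇒adj : 2 ≤ size X → ∀ a b → dist X a b ≡ 1 → adj X a b ≡ true
  dist≡1⇒adj two a b d≡1 with reach₁⇒ a b (reach-dist a b 1 d≡1 two)
  ... | inj₂ ab = ab
  ... | inj₁ refl = contradiction (trans (sym (dist-self (≤-trans (s≤s z≤n) two) a)) d≡1) λ ()

  commonNeighbour⇒dist≡2 : 3 ≤ size X → ∀ a b c → a ≢ b → adj X a b ≡ false →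
    adj X a c ≡ true → adj X c b ≡ true → dist X a b ≡ 2
  commonNeighbour⇒dist≡2 three a b c a≢b ab ac cb =
    search-least _ (size X) 2 three (reach-step 1 a c b (adj⇒reach₁ a c ac) cb)
      λ { zero _ → ==-false a≢b ; (suc zero) _ → reach₁-false a b a≢b ab ; (suc (suc _)) (s≤s (s≤s ())) }

  connected⇒neighbour : Connected X → 2 ≤ size X → ∀ a → ∃ λ t → adj X a t ≡ true
  connected⇒neighbour connected two a with distinctPair two
  ... | x , y , x≢y with a ≟ x
  ...   | yes refl = reach⇒neighbour (proj₁ (connected a y)) a y (proj₂ (connected a y)) x≢y
  ...   | no a≢x = reach⇒neighbour (proj₁ (connected a x)) a x (proj₂ (connected a x)) a≢x

  dist-cong : ∀ a b c d → (∀ m → reach X m a b ≡ reach X m c d) → dist X a b ≡ dist X c d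
  dist-cong a b c d same = search-cong _ _ same 0 (size X)

  module _ (loopless : Loopless X) (two : 2 ≤ size X) where

    adjacency-resolves : ∀ a b w → adj X a w ≡ true → adj X b w ≡ false → dist X a w ≢ dist X b w
    adjacency-resolves a b w aw bw same =
      true≢false (trans (sym (dist≡1⇒adj two b w (trans (sym same) (adj⇒dist≡1 two a w a≢w aw)))) bw)
      where
        a≢w : a ≢ w
        a≢w refl = true≢false (trans (sym aw) (loopless a))

    self-resolves : ∀ a b → a ≢ b → dist X a a ≢ dist X b a
    self-resolves a b a≢b same = a≢b (sym (dist≡0⇒≡ pos b a (trans (sym same) (dist-self pos a))))
      where
        pos : 1 ≤ size X
        pos = ≤-trans (s≤s z≤n) two

    adjDistinguisher-resolves : ∀ x y w → x ≢ y → adjDistinguishers X x y w ≡ true → dist X x w ≢ dist X y w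
    adjDistinguisher-resolves x y w x≢y d with w ≟ x | w ≟ y | adj X x w in xw | adj X y w in yw
    ... | yes refl | _        | _     | _     = self-resolves x y x≢y
    ... | no _     | yes refl | _     | _     = self-resolves y x (≢-sym x≢y) ∘ sym
    ... | no _     | no _     | true  | false = adjacency-resolves x y w xw yw
    ... | no _     | no _     | false | true  = adjacency-resolves y x w yw xw ∘ sym

    adjGen⇒metricGen : ∀ k S → IsKAdjGen X k S → IsKMetricGen X k S
    adjGen⇒metricGen k S gen x y x≢y =
      ≤-trans (gen x y x≢y)
        (count-mono _ _ λ w → ∧-monoʳ (≢⇒not-≡ᵇ ∘ adjDistinguisher-resolves x y w x≢y))

open Distances

module _ (X : Graph) where

  adjDistinguishers-≢ : ∀ x y w → adj X x w ≢ adj X y w → adjDistinguishers X x y w ≡ true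
  adjDistinguishers-≢ x y w differ = ∨-injˡ (xor-true differ)

  adjDistinguishers-comm : ∀ x y w → adjDistinguishers X x y w ≡ adjDistinguishers X y x w
  adjDistinguishers-comm x y w rewrite xor-comm (adj X x w) (adj X y w) =
    cong ((adj X y w xor adj X x w) ∨_) (∨-comm (w == x) (w == y))

  adjDistinguishers-left : ∀ x y → adjDistinguishers X x y x ≡ true
  adjDistinguishers-left x y rewrite ==-refl x | ∨-zeroʳ (adj X x x xor adj X y x) = refl

adjGen⇒k≤count : ∀ (K : Graph) k S → 2 ≤ size K → IsKAdjGen K k S → k ≤ count S
adjGen⇒k≤count K k S two gen with distinctPair two
... | a , b , a≢b = ≤-trans (gen a b a≢b) (count-∧≤ S (adjDistinguishers K a b))

adim⇒basis : ∀ (K : Graph) k a → IsAdimK K k a → Σ (Subset (size K)) (IsKAdjBasis K k)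
adim⇒basis K k a ((S , gen , |S|≡a) , minimal) =
  S , gen , λ T genT → ≤-trans (≤-reflexive |S|≡a) (minimal T genT)

basis-count : ∀ (K : Graph) k a A → IsAdimK K k a → IsKAdjBasis K k A → count A ≡ a
basis-count K k a A ((S , gen , |S|≡a) , minimal) (genA , minimalA) =
  ≤-antisym (≤-trans (minimalA S gen) (≤-reflexive |S|≡a)) (minimal A genA)

-- Twin classes

module Twins (G : Graph) (symG : ∀ x y → adj G x y ≡ adj G y x) where

  twin⇒sameAdj : ∀ x y → twin G x y ≡ true → ∀ z → z ≢ x → z ≢ y → adj G x z ≡ adj G y z
  twin⇒sameAdj x y tw z z≢x z≢y = xor-false differs
    where
      differs : adj G x z xor adj G y z ≡ false
      differs with anyF-false _ (not-true tw) z
      ... | none rewrite ==-false z≢x | ==-false z≢y = none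

  sameAdj⇒twin : ∀ x y → (∀ z → z ≢ x → z ≢ y → adj G x z ≡ adj G y z) → twin G x y ≡ true
  sameAdj⇒twin x y same = cong not (anyF-none _ noDistinguisher)
    where
      noDistinguisher : ∀ z → (not (z == x) ∧ not (z == y) ∧ (adj G x z xor adj G y z)) ≡ false
      noDistinguisher z with z ≟ x | z ≟ y
      ... | yes _   | _       = refl
      ... | no _    | yes _   = refl
      ... | no z≢x  | no z≢y  rewrite same z z≢x z≢y = xor-same (adj G y z)

  ¬twin⇒distinguisher : ∀ x y → twin G x y ≡ false → ∃ λ z → z ≢ x × z ≢ y × adj G x z ≢ adj G y z
  ¬twin⇒distinguisher x y ¬tw
    with anyF-witness (λ z → not (z == x) ∧ not (z == y) ∧ (adj G x z xor adj G y z)) (not-false ¬tw)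
  ... | z , found with z ≟ x | z ≟ y
  ...   | no z≢x | no z≢y = z , z≢x , z≢y , xor-true⇒≢ found

  twin-refl : ∀ x → twin G x x ≡ true
  twin-refl x = sameAdj⇒twin x x λ _ _ _ → refl

  twin-sym : ∀ x y → twin G x y ≡ true → twin G y x ≡ true
  twin-sym x y tw = sameAdj⇒twin y x λ z z≢y z≢x → sym (twin⇒sameAdj x y tw z z≢x z≢y)

  twin-trans : ∀ x y z → twin G x y ≡ true → twin G y z ≡ true → twin G x z ≡ true
  twin-trans x y z xy yz with x ≟ y | y ≟ z | x ≟ z
  ... | yes refl | _        | _        = yz
  ... | no _     | yes refl | _        = xy
  ... | no _     | no _     | yes refl = twin-refl x
  ... | no x≢y   | no y≢z   | no x≢z   = sameAdj⇒twin x z same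
    where
      same : ∀ w → w ≢ x → w ≢ z → adj G x w ≡ adj G z w
      same w w≢x w≢z with w ≟ y
      ... | yes refl = begin
        adj G x w ≡⟨ symG x w ⟩
        adj G w x ≡⟨ twin⇒sameAdj w z yz x x≢y x≢z ⟩
        adj G z x ≡⟨ symG z x ⟩
        adj G x z ≡⟨ twin⇒sameAdj x w xy z (≢-sym x≢z) (≢-sym y≢z) ⟩
        adj G w z ≡⟨ symG w z ⟩
        adj G z w ∎
        where open ≡-Reasoning
      ... | no w≢y = trans (twin⇒sameAdj x y xy w w≢x w≢y) (twin⇒sameAdj y z yz w w≢y w≢z)

  classmates : ∀ {c i j} → InClass G c i → InClass G c j → twin G i j ≡ true
  classmates {c} {i} {j} ci cj = twin-trans i c j (twin-sym c i ci) cj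

  classPair⇒centreNeighbour : ∀ c i j → InClass G c i → InClass G c j → i ≢ j →
    ∃ λ t → t ≢ c × InClass G c t × adj G c t ≡ adj G i j
  classPair⇒centreNeighbour c i j ci cj i≢j with c ≟ i | c ≟ j
  ... | yes refl | _        = j , ≢-sym i≢j , cj , refl
  ... | no _     | yes refl = i , i≢j , ci , symG j i
  ... | no c≢i   | no _     = i , ≢-sym c≢i , ci , trans (twin⇒sameAdj c j cj i (≢-sym c≢i) i≢j) (symG j i)

  centreNeighbours-agree : ∀ c t t′ → t ≢ c → t′ ≢ c → InClass G c t → InClass G c t′ →
    adj G c t ≡ adj G c t′
  centreNeighbours-agree c t t′ t≢c t′≢c ct ct′ with t ≟ t′
  ... | yes refl = refl
  ... | no _ = begin
    adj G c t  ≡⟨ symG c t ⟩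
    adj G t c  ≡⟨ twin⇒sameAdj t t′ (classmates ct ct′) c (≢-sym t≢c) (≢-sym t′≢c) ⟩
    adj G t′ c ≡⟨ symG t′ c ⟩
    adj G c t′ ∎
    where open ≡-Reasoning

  InTT⇒classAdjacent : ∀ {c i j} → InTT G c → InClass G c i → InClass G c j → i ≢ j → adj G i j ≡ true
  InTT⇒classAdjacent {c} {i} {j} (t , t≢c , ct , adj-ct) ci cj i≢j
    with classPair⇒centreNeighbour c i j ci cj i≢j
  ... | t′ , t′≢c , ct′ , same =
    trans (sym same) (trans (centreNeighbours-agree c t′ t t′≢c t≢c ct′ ct) adj-ct)

  classPair⇒InTT : ∀ {c i j} → InClass G c i → InClass G c j → i ≢ j → adj G i j ≡ true → InTT G c
  classPair⇒InTT {c} {i} {j} ci cj i≢j ij with classPair⇒centreNeighbour c i j ci cj i≢j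
  ... | t , t≢c , ct , same = t , t≢c , ct , trans same ij

  classPair⇒InFT : ∀ {c i j} → InClass G c i → InClass G c j → i ≢ j → adj G i j ≡ false → InFT G c
  classPair⇒InFT {c} {i} {j} ci cj i≢j ij with classPair⇒centreNeighbour c i j ci cj i≢j
  ... | t , t≢c , ct , same = t , t≢c , ct , trans same ij

  classRep : Fin (size G) → Fin (size G)
  classRep j = choose j (twin G j)

  classRep-inClass : ∀ j → InClass G (classRep j) j
  classRep-inClass j = twin-sym j _ (choose-satisfies j (twin G j) (twin-refl j))

  classRep-cong : ∀ i j → twin G i j ≡ true → classRep i ≡ classRep j
  classRep-cong i j ij = choose-cong i j (twin G i) (twin G j) (twin-refl i)
    λ x → ≡true-ext (twin-trans j i x (twin-sym i j ij)) (twin-trans i j x ij)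

  InTT? : ∀ c → Dec (InTT G c)
  InTT? c = any? λ t → ¬? (t ≟ c) ×-dec (twin G c t ≟ᵇ true) ×-dec (adj G c t ≟ᵇ true)

  InFT? : ∀ c → Dec (InFT G c)
  InFT? c = any? λ t → ¬? (t ≟ c) ×-dec (twin G c t ≟ᵇ true) ×-dec (adj G c t ≟ᵇ false)

-- The lexicographic product

sameBlockAdj-refl : ∀ {n} (K : Fin n → Graph) i v w → sameBlockAdj K i i v w ≡ adj (K i) v w
sameBlockAdj-refl K i v w with i ≟ i
... | yes refl = refl
... | no i≢i = contradiction refl i≢i

sameBlockAdj-≢ : ∀ {n} (K : Fin n → Graph) i j v w → i ≢ j → sameBlockAdj K i j v w ≡ false
sameBlockAdj-≢ K i j v w i≢j with i ≟ j
... | yes i≡j = contradiction i≡j i≢j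
... | no _ = refl

sameBlockAdj⇒≡ : ∀ {n} (K : Fin n → Graph) i j v w → sameBlockAdj K i j v w ≡ true → i ≡ j
sameBlockAdj⇒≡ K i j v w e with i ≟ j
... | yes i≡j = i≡j

TwinPairBound : (G : Graph) (K : Fin (size G) → Graph) → ℕ → ((i : Fin (size G)) → Subset (size (K i))) →
  Bool → ((H : Graph) → Fin (size H) → Subset (size H)) → Set
TwinPairBound G K k B adjacent F = ∀ i j → i ≢ j → twin G i j ≡ true → adj G i j ≡ adjacent →
  ∀ v w → k ≤ count (λ z → B i z ∧ F (K i) v z) + count (λ z → B j z ∧ F (K j) w z)

module Lex (G : Graph) (K : Fin (size G) → Graph) (simpleG : IsSimple G) where

  symG : ∀ i j → adj G i j ≡ adj G j i
  symG = proj₁ simpleG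

  looplessG : Loopless G
  looplessG = proj₂ simpleG

  open Twins G symG using (¬twin⇒distinguisher)

  X : Graph
  X = lex G K

  ⟨_,_⟩ : (i : Fin (size G)) → Fin (size (K i)) → Fin (size X)
  ⟨ i , v ⟩ = unsplit (sizes K) i v

  block : Fin (size X) → Fin (size G)
  block x = proj₁ (split (sizes K) x)

  block-⟨⟩ : ∀ i v → block ⟨ i , v ⟩ ≡ i
  block-⟨⟩ i v = cong proj₁ (split-unsplit (sizes K) i v)

  ⟨⟩-≢ʳ : ∀ {i v w} → v ≢ w → ⟨ i , v ⟩ ≢ ⟨ i , w ⟩
  ⟨⟩-≢ʳ v≢w = v≢w ∘ unsplit-injectiveʳ (sizes K)

  ⟨⟩-== : ∀ i v w → (⟨ i , v ⟩ == ⟨ i , w ⟩) ≡ (v == w)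
  ⟨⟩-== i v w with v ≟ w
  ... | yes refl = ==-refl ⟨ i , v ⟩
  ... | no v≢w = ==-false (⟨⟩-≢ʳ v≢w)

  adj-⟨⟩ : ∀ i v j w → adj X ⟨ i , v ⟩ ⟨ j , w ⟩ ≡ adj G i j ∨ sameBlockAdj K i j v w
  adj-⟨⟩ i v j w rewrite split-unsplit (sizes K) i v | split-unsplit (sizes K) j w = refl

  adj-sameBlock : ∀ i v w → adj X ⟨ i , v ⟩ ⟨ i , w ⟩ ≡ adj (K i) v w
  adj-sameBlock i v w rewrite adj-⟨⟩ i v i w | looplessG i = sameBlockAdj-refl K i v w

  adj-otherBlock : ∀ {i j} v w → i ≢ j → adj X ⟨ i , v ⟩ ⟨ j , w ⟩ ≡ adj G i j
  adj-otherBlock {i} {j} v w i≢j rewrite adj-⟨⟩ i v j w | sameBlockAdj-≢ K i j v w i≢j = ∨-identityʳ (adj G i j)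

  adj⇒sameBlock⊎adjacentBlocks : ∀ x y → adj X x y ≡ true →
    block x ≡ block y ⊎ adj G (block x) (block y) ≡ true
  adj⇒sameBlock⊎adjacentBlocks x y xy with ∨-cases {adj G (block x) (block y)} xy
  ... | inj₁ blocks = inj₂ blocks
  ... | inj₂ same = inj₁ (sameBlockAdj⇒≡ K _ _ _ _ same)

  lex-loopless : (∀ i → Loopless (K i)) → Loopless X
  lex-loopless looplessK x rewrite looplessG (block x) =
    trans (sameBlockAdj-refl K (block x) _ _) (looplessK (block x) _)

  ⟨⟩-elim : (P : Fin (size X) → Set) → (∀ i v → P ⟨ i , v ⟩) → ∀ x → P x
  ⟨⟩-elim P P⟨⟩ x = subst P (unsplit-split (sizes K) x) (P⟨⟩ (block x) (proj₂ (split (sizes K) x)))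

  adjDistinguishers-sameBlock : ∀ i v w z →
    adjDistinguishers X ⟨ i , v ⟩ ⟨ i , w ⟩ ⟨ i , z ⟩ ≡ adjDistinguishers (K i) v w z
  adjDistinguishers-sameBlock i v w z
    rewrite adj-sameBlock i v z | adj-sameBlock i w z | ⟨⟩-== i z v | ⟨⟩-== i z w = refl

  ownBlock-adjDistinguisher : ∀ {i j} v w z b → i ≢ j → adj (K i) v z ≡ b → adj G j i ≡ not b →
    adjDistinguishers X ⟨ i , v ⟩ ⟨ j , w ⟩ ⟨ i , z ⟩ ≡ true
  ownBlock-adjDistinguisher {i} {j} v w z b i≢j vz ji = adjDistinguishers-≢ X _ _ _
    (subst₂ _≢_ (sym (trans (adj-sameBlock i v z) vz)) (sym (trans (adj-otherBlock w z (≢-sym i≢j)) ji))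
      (not-¬ refl))

  nonNbr⇒adjDistinguisher : ∀ {i j} v w z → i ≢ j → adj G i j ≡ true → nonNbr (K i) v z ≡ true →
    adjDistinguishers X ⟨ i , v ⟩ ⟨ j , w ⟩ ⟨ i , z ⟩ ≡ true
  nonNbr⇒adjDistinguisher {i} {j} v w z i≢j ij vz =
    ownBlock-adjDistinguisher v w z false i≢j (not-true vz) (trans (symG j i) ij)

  closedNbr⇒adjDistinguisher : ∀ {i j} v w z → i ≢ j → adj G i j ≡ false → closedNbr (K i) v z ≡ true →
    adjDistinguishers X ⟨ i , v ⟩ ⟨ j , w ⟩ ⟨ i , z ⟩ ≡ true
  closedNbr⇒adjDistinguisher {i} {j} v w z i≢j ij vz with ∨-cases vz
  ... | inj₁ adjacent = ownBlock-adjDistinguisher v w z true i≢j adjacent (trans (symG j i) ij)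
  ... | inj₂ z=v rewrite ==⇒≡ z=v = adjDistinguishers-left X ⟨ i , v ⟩ ⟨ j , w ⟩

  reach-project : ∀ m x y → reach X m x y ≡ true → reach G m (block x) (block y) ≡ true
  reach-project zero x y r rewrite ==⇒≡ r = ==-refl (block y)
  reach-project (suc m) x y r with ∨-cases r
  ... | inj₁ r′ = ∨-injˡ (reach-project m x y r′)
  ... | inj₂ step with anyF-witness (λ c → reach X m x c ∧ adj X c y) step
  ...   | c , xc∧cy with adj⇒sameBlock⊎adjacentBlocks c y (∧-projʳ xc∧cy)
  ...     | inj₁ same =
    ∨-injˡ (subst (λ b → reach G m (block x) b ≡ true) same (reach-project m x c (∧-projˡ xc∧cy)))
  ...     | inj₂ blocks =
    reach-step G m (block x) (block c) (block y) (reach-project m x c (∧-projˡ xc∧cy)) blocks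

  module UpperBound (k : ℕ) (B : (i : Fin (size G)) → Subset (size (K i))) where

    union : Subset (size X)
    union x = B (block x) (proj₂ (split (sizes K) x))

    union-⟨⟩ : ∀ i z → union ⟨ i , z ⟩ ≡ B i z
    union-⟨⟩ i z rewrite split-unsplit (sizes K) i z = refl

    count-union : count union ≡ sumF (count ∘ B)
    count-union = trans (count-blocks (sizes K) union) (sumF-cong _ _ λ i → count-cong _ _ (union-⟨⟩ i))

    distinguishing : Fin (size X) → Fin (size X) → Subset (size X)
    distinguishing x y w = union w ∧ adjDistinguishers X x y w

    distinguishing-⟨⟩ : ∀ x y i z → B i z ≡ true → adjDistinguishers X x y ⟨ i , z ⟩ ≡ true →
      distinguishing x y ⟨ i , z ⟩ ≡ true
    distinguishing-⟨⟩ x y i z b d = ∧-introᵇ (trans (union-⟨⟩ i z) b) d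

    twinBlocks-bound : ∀ {i j} v w → i ≢ j → (F : (H : Graph) → Fin (size H) → Subset (size H)) →
      (∀ z → F (K i) v z ≡ true → adjDistinguishers X ⟨ i , v ⟩ ⟨ j , w ⟩ ⟨ i , z ⟩ ≡ true) →
      (∀ z → F (K j) w z ≡ true → adjDistinguishers X ⟨ j , w ⟩ ⟨ i , v ⟩ ⟨ j , z ⟩ ≡ true) →
      count (λ z → B i z ∧ F (K i) v z) + count (λ z → B j z ∧ F (K j) w z)
        ≤ count (distinguishing ⟨ i , v ⟩ ⟨ j , w ⟩)
    twinBlocks-bound {i} {j} v w i≢j F own other =
      count-twoBlocks (sizes K) _ i≢j (λ z → B i z ∧ F (K i) v z) (λ z → B j z ∧ F (K j) w z)
        (λ z e → distinguishing-⟨⟩ _ _ i z (∧-projˡ {B i z} e) (own z (∧-projʳ {B i z} e)))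
        (λ z e → distinguishing-⟨⟩ _ _ j z (∧-projˡ {B j z} e)
                   (trans (adjDistinguishers-comm X _ _ _) (other z (∧-projʳ {B j z} e))))

    sameBlock-bound : ∀ i v w → IsKAdjGen (K i) k (B i) → v ≢ w →
      k ≤ count (distinguishing ⟨ i , v ⟩ ⟨ i , w ⟩)
    sameBlock-bound i v w gen v≢w = ≤-trans (gen v w v≢w) (count-oneBlock (sizes K) _ i _
      λ z e → distinguishing-⟨⟩ _ _ i z (∧-projˡ {B i z} e)
                (trans (adjDistinguishers-sameBlock i v w z) (∧-projʳ {B i z} e)))

    nonTwins-bound : ∀ {i j} v w → (∀ l → k ≤ count (B l)) → twin G i j ≡ false →
      k ≤ count (distinguishing ⟨ i , v ⟩ ⟨ j , w ⟩)
    nonTwins-bound {i} {j} v w large ¬tw with ¬twin⇒distinguisher i j ¬tw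
    ... | l , l≢i , l≢j , differ = ≤-trans (large l) (count-oneBlock (sizes K) _ l (B l)
      λ z b → distinguishing-⟨⟩ _ _ l z b (adjDistinguishers-≢ X _ _ _
        (subst₂ _≢_ (sym (adj-otherBlock v z (≢-sym l≢i))) (sym (adj-otherBlock w z (≢-sym l≢j))) differ)))

    union-adjGen : (∀ i → IsKAdjGen (K i) k (B i)) → (∀ i → k ≤ count (B i)) →
      TwinPairBound G K k B true nonNbr → TwinPairBound G K k B false closedNbr → IsKAdjGen X k union
    union-adjGen gen large trueTwins falseTwins x y =
      ⟨⟩-elim (λ x → x ≢ y → k ≤ count (distinguishing x y))
        (λ i v → ⟨⟩-elim (λ y → ⟨ i , v ⟩ ≢ y → k ≤ count (distinguishing ⟨ i , v ⟩ y)) (pairs i v) y) x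
      where
        pairs : ∀ i v j w → ⟨ i , v ⟩ ≢ ⟨ j , w ⟩ → k ≤ count (distinguishing ⟨ i , v ⟩ ⟨ j , w ⟩)
        pairs i v j w x≢y with i ≟ j
        ... | yes refl = sameBlock-bound i v w (gen i) (x≢y ∘ cong ⟨ i ,_⟩)
        ... | no i≢j with twin G i j in tw | adj G i j in ij
        ...   | false | _     = nonTwins-bound v w large tw
        ...   | true  | true  = ≤-trans (trueTwins i j i≢j tw ij v w) (twinBlocks-bound v w i≢j nonNbr
                (λ z → nonNbr⇒adjDistinguisher v w z i≢j ij)
                (λ z → nonNbr⇒adjDistinguisher w v z (≢-sym i≢j) (trans (symG j i) ij)))
        ...   | true  | false = ≤-trans (falseTwins i j i≢j tw ij v w) (twinBlocks-bound v w i≢j closedNbr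
                (λ z → closedNbr⇒adjDistinguisher v w z i≢j ij)
                (λ z → closedNbr⇒adjDistinguisher w v z (≢-sym i≢j) (trans (symG j i) ij)))

  module LowerBound (connected : Connected G) (twoG : 2 ≤ size G) (twoK : ∀ i → 2 ≤ size (K i)) where

    point : ∀ i → Fin (size (K i))
    point i = proj₁ (distinctPair (twoK i))

    three : 3 ≤ size X
    three with distinctPair twoG
    ... | i , j , i≢j =
      ≤-trans (s≤s (s≤s (s≤s z≤n))) (≤-trans (+-mono-≤ (twoK i) (twoK j)) (twoTerms≤sumF (sizes K) i j i≢j))

    two : 2 ≤ size X
    two = ≤-trans (s≤s (s≤s z≤n)) three

    reach-lift : ∀ m i l → i ≢ l → reach G m i l ≡ true → ∀ v z → reach X m ⟨ i , v ⟩ ⟨ l , z ⟩ ≡ true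
    reach-lift zero i l i≢l r = contradiction (==⇒≡ r) i≢l
    reach-lift (suc m) i l i≢l r v z with ∨-cases r
    ... | inj₁ r′ = ∨-injˡ (reach-lift m i l i≢l r′ v z)
    ... | inj₂ step with anyF-witness (λ c → reach G m i c ∧ adj G c l) step
    ...   | c , ic∧cl with i ≟ c
    ...     | yes refl =
      reach-step X m _ _ _ (reach-refl X m ⟨ i , v ⟩) (trans (adj-otherBlock v z i≢l) (∧-projʳ ic∧cl))
    ...     | no i≢c = reach-step X m _ ⟨ c , point c ⟩ _ (reach-lift m i c i≢c (∧-projˡ ic∧cl) v (point c))
                         (trans (adj-otherBlock (point c) z c≢l) (∧-projʳ ic∧cl))
      where
        c≢l : c ≢ l
        c≢l refl = true≢false (trans (sym (∧-projʳ ic∧cl)) (looplessG c))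

    reach-otherBlock : ∀ {i l} v z → i ≢ l → ∀ m → reach X m ⟨ i , v ⟩ ⟨ l , z ⟩ ≡ reach G m i l
    reach-otherBlock {i} {l} v z i≢l m = ≡true-ext
      (λ r → subst₂ (λ a b → reach G m a b ≡ true) (block-⟨⟩ i v) (block-⟨⟩ l z) (reach-project m _ _ r))
      (λ r → reach-lift m i l i≢l r v z)

    dist-otherBlock : ∀ {i l} v v′ z → i ≢ l → dist X ⟨ i , v ⟩ ⟨ l , z ⟩ ≡ dist X ⟨ i , v′ ⟩ ⟨ l , z ⟩
    dist-otherBlock v v′ z i≢l = dist-cong X _ _ _ _ λ m →
      trans (reach-otherBlock v z i≢l m) (sym (reach-otherBlock v′ z i≢l m))

    dist-sameBlock : ∀ i v z → v ≢ z → dist X ⟨ i , v ⟩ ⟨ i , z ⟩ ≡ (if adj (K i) v z then 1 else 2)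
    dist-sameBlock i v z v≢z with adj (K i) v z in vz
    ... | true = adj⇒dist≡1 X two _ _ (⟨⟩-≢ʳ v≢z) (trans (adj-sameBlock i v z) vz)
    ... | false with connected⇒neighbour G connected twoG i
    ...   | t , it = commonNeighbour⇒dist≡2 X three _ _ ⟨ t , point t ⟩ (⟨⟩-≢ʳ v≢z)
      (trans (adj-sameBlock i v z) vz)
      (trans (adj-otherBlock v (point t) i≢t) it)
      (trans (adj-otherBlock (point t) z (≢-sym i≢t)) (trans (symG t i) it))
      where
        i≢t : i ≢ t
        i≢t refl = true≢false (trans (sym it) (looplessG i))

    dist-sameBlock-agree : ∀ i v v′ z → z ≢ v → z ≢ v′ → adj (K i) v z ≡ adj (K i) v′ z →
      dist X ⟨ i , v ⟩ ⟨ i , z ⟩ ≡ dist X ⟨ i , v′ ⟩ ⟨ i , z ⟩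
    dist-sameBlock-agree i v v′ z z≢v z≢v′ same
      rewrite dist-sameBlock i v z (≢-sym z≢v) | dist-sameBlock i v′ z (≢-sym z≢v′) =
        cong (if_then 1 else 2) same

    sameBlock-resolving⇒adjDistinguisher : ∀ i v v′ z →
      dist X ⟨ i , v ⟩ ⟨ i , z ⟩ ≢ dist X ⟨ i , v′ ⟩ ⟨ i , z ⟩ → adjDistinguishers (K i) v v′ z ≡ true
    sameBlock-resolving⇒adjDistinguisher i v v′ z resolves with z ≟ v | z ≟ v′
    ... | yes refl | _        = ∨-injʳ refl
    ... | no _     | yes refl = ∨-injʳ {adj (K i) v z xor adj (K i) z z} (∨-injʳ {false} refl)
    ... | no z≢v   | no z≢v′ with adj (K i) v z in vz | adj (K i) v′ z in v′z
    ...   | true  | false = refl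
    ...   | false | true  = refl
    ...   | true  | true  = contradiction (dist-sameBlock-agree i v v′ z z≢v z≢v′ (trans vz (sym v′z))) resolves
    ...   | false | false = contradiction (dist-sameBlock-agree i v v′ z z≢v z≢v′ (trans vz (sym v′z))) resolves

    metricGen⇒adjGen : ∀ k S → IsKMetricGen X k S → ∀ i → IsKAdjGen (K i) k (S ∘ ⟨ i ,_⟩)
    metricGen⇒adjGen k S gen i v v′ v≢v′ = begin
      k                                ≤⟨ gen x y (⟨⟩-≢ʳ v≢v′) ⟩
      count resolving                  ≡⟨ count-withinBlock (sizes K) resolving i outside ⟩
      count (resolving ∘ ⟨ i ,_⟩)      ≤⟨ count-mono _ _ (λ z → ∧-monoʳ (resolves⇒adjDistinguisher z ∘ not-≡ᵇ⇒≢)) ⟩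
      count (λ z → S ⟨ i , z ⟩ ∧ adjDistinguishers (K i) v v′ z) ∎
      where
        open ≤-Reasoning
        x = ⟨ i , v ⟩
        y = ⟨ i , v′ ⟩
        resolving : Subset (size X)
        resolving w = S w ∧ not (dist X x w ≡ᵇ dist X y w)
        outside : ∀ l → l ≢ i → ∀ z → resolving ⟨ l , z ⟩ ≡ false
        outside l l≢i z rewrite dist-otherBlock v v′ z (≢-sym l≢i) =
          trans (cong (S ⟨ l , z ⟩ ∧_) (not-≡ᵇ-refl (dist X y ⟨ l , z ⟩))) (∧-zeroʳ _)
        resolves⇒adjDistinguisher : ∀ z → dist X x ⟨ i , z ⟩ ≢ dist X y ⟨ i , z ⟩ →
          adjDistinguishers (K i) v v′ z ≡ true
        resolves⇒adjDistinguisher = sameBlock-resolving⇒adjDistinguisher i v v′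

    dim-lowerBound : ∀ k (a : Fin (size G) → ℕ) → (∀ i → IsAdimK (K i) k (a i)) →
      ∀ S → IsKMetricGen X k S → sumF a ≤ count S
    dim-lowerBound k a adim S gen = ≤-trans
      (sumF-mono _ _ λ i → proj₂ (adim i) (S ∘ ⟨ i ,_⟩) (metricGen⇒adjGen k S gen i))
      (≤-reflexive (sym (count-blocks (sizes K) S)))

-- Choosing the bases class by class

module ClassBases (G : Graph) (simpleG : IsSimple G) (H : Fin (size G) → Graph) (k : ℕ)
  (F₁ F₂ : (K : Graph) → Fin (size K) → Subset (size K))
  (p₁ : PropertyShape G H k (InTT G) F₁) (p₂ : PropertyShape G H k (InFT G) F₂)
  (fallback : ∀ j → Σ (Subset (size (H j))) (IsKAdjBasis (H j) k)) where

  open Twins G (proj₁ simpleG)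

  classBasis : ∀ c → Dec (InTT G c) → Dec (InFT G c) → (j : Fin (size G)) → Subset (size (H j))
  classBasis c (yes tt) _        j = proj₁ (p₁ c tt) j
  classBasis c (no _)   (yes ft) j = proj₁ (p₂ c ft) j
  classBasis c (no _)   (no _)   j = proj₁ (fallback j)

  classBasis-isBasis : ∀ c tt? ft? j → InClass G c j → IsKAdjBasis (H j) k (classBasis c tt? ft? j)
  classBasis-isBasis c (yes tt) _        j cj = proj₁ (proj₂ (p₁ c tt)) j cj
  classBasis-isBasis c (no _)   (yes ft) j cj = proj₁ (proj₂ (p₂ c ft)) j cj
  classBasis-isBasis c (no _)   (no _)   j cj = proj₂ (fallback j)

  ClassPairBound : (Fin (size G) → (j : Fin (size G)) → Subset (size (H j))) →
    Bool → ((K : Graph) → Fin (size K) → Subset (size K)) → Set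
  ClassPairBound A adjacent F = ∀ c i j → InClass G c i → InClass G c j → i ≢ j → adj G i j ≡ adjacent →
    ∀ v w → k ≤ count (λ z → A c i z ∧ F (H i) v z) + count (λ z → A c j z ∧ F (H j) w z)

  basisOfClass : Fin (size G) → (j : Fin (size G)) → Subset (size (H j))
  basisOfClass c = classBasis c (InTT? c) (InFT? c)

  basisOfClass-trueTwins : ClassPairBound basisOfClass true F₁
  basisOfClass-trueTwins c i j ci cj i≢j ij with InTT? c
  ... | yes tt = proj₂ (proj₂ (p₁ c tt)) i j ci cj i≢j
  ... | no ¬tt = contradiction (classPair⇒InTT ci cj i≢j ij) ¬tt

  basisOfClass-falseTwins : ClassPairBound basisOfClass false F₂
  basisOfClass-falseTwins c i j ci cj i≢j ij with InTT? c | InFT? c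
  ... | yes tt | _      = contradiction (trans (sym (InTT⇒classAdjacent tt ci cj i≢j)) ij) true≢false
  ... | no _   | yes ft = proj₂ (proj₂ (p₂ c ft)) i j ci cj i≢j
  ... | no _   | no ¬ft = contradiction (classPair⇒InFT ci cj i≢j ij) ¬ft

  -- P₁ and P₂ give bases for the whole class of each vertex; reading them off at one canonical
  -- representative per class makes the choice for twins consistent.
  B : (j : Fin (size G)) → Subset (size (H j))
  B j = basisOfClass (classRep j) j

  B-isBasis : ∀ j → IsKAdjBasis (H j) k (B j)
  B-isBasis j = classBasis-isBasis (classRep j) (InTT? (classRep j)) (InFT? (classRep j)) j (classRep-inClass j)

  B-twinPairBound : ∀ {adjacent F} → ClassPairBound basisOfClass adjacent F → TwinPairBound G H k B adjacent F
  B-twinPairBound {adjacent} {F} bound i j i≢j tw ij v w =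
    subst (λ c → k ≤ count (λ z → B i z ∧ F (H i) v z) + count (λ z → basisOfClass c j z ∧ F (H j) w z))
      (classRep-cong i j tw)
      (bound (classRep i) i j (classRep-inClass i) cj i≢j ij v w)
    where
      cj : InClass G (classRep i) j
      cj = subst (λ c → InClass G c j) (sym (classRep-cong i j tw)) (classRep-inClass j)

-- Complements

module _ (K : Graph) where

  complement-simple : IsSimple K → IsSimple (complement K)
  complement-simple (symK , looplessK) =
    (λ x y → cong₂ (λ a b → not a ∧ not b) (symK x y) (==-sym x y)) ,
    (λ x → trans (cong (λ b → not (adj K x x) ∧ not b) (==-refl x)) (∧-zeroʳ _))

  adjDistinguishers-complement : ∀ x y w → adjDistinguishers (complement K) x y w ≡ adjDistinguishers K x y w
  adjDistinguishers-complement x y w with w ≟ x | w ≟ y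
  ... | yes refl | _        = trans (∨-injʳ refl) (sym (∨-injʳ refl))
  ... | no _     | yes refl = trans (∨-injʳ refl) (sym (∨-injʳ refl))
  ... | no w≢x   | no w≢y   rewrite ==-sym x w | ==-sym y w | ==-false w≢x | ==-false w≢y
                                  | ∧-identityʳ (not (adj K x w)) | ∧-identityʳ (not (adj K y w)) =
    cong (_∨ false) (xor-annihilates-not (adj K x w) (adj K y w))

  adjGen-fromComplement : ∀ k S → IsKAdjGen (complement K) k S → IsKAdjGen K k S
  adjGen-fromComplement k S gen x y x≢y =
    subst (k ≤_) (count-cong _ _ λ w → cong (S w ∧_) (adjDistinguishers-complement x y w)) (gen x y x≢y)

  adjGen-toComplement : ∀ k S → IsKAdjGen K k S → IsKAdjGen (complement K) k S
  adjGen-toComplement k S gen x y x≢y =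
    subst (k ≤_) (count-cong _ _ λ w → cong (S w ∧_) (sym (adjDistinguishers-complement x y w))) (gen x y x≢y)

  adim-complement : ∀ k a → IsAdimK K k a → IsAdimK (complement K) k a
  adim-complement k a ((S , gen , |S|) , minimal) =
    (S , adjGen-toComplement k S gen , |S|) , λ T genT → minimal T (adjGen-fromComplement k T genT)

  basis-complement : ∀ k A → IsKAdjBasis K k A → IsKAdjBasis (complement K) k A
  basis-complement k A (gen , minimal) =
    adjGen-toComplement k A gen , λ T genT → minimal T (adjGen-fromComplement k T genT)

  openNbr⇒complement-nonNbr : ∀ x v → openNbr K x v ≡ true → nonNbr (complement K) x v ≡ true
  openNbr⇒complement-nonNbr x v xv rewrite xv = refl

  nonNbr⇒complement-closedNbr : ∀ x v → nonNbr K x v ≡ true → closedNbr (complement K) x v ≡ true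
  nonNbr⇒complement-closedNbr x v xv with x ≟ v
  ... | yes refl = ∨-injʳ (==-refl x)
  ... | no _ rewrite not-true xv = refl

PropertyShape-complement : ∀ (G : Graph) (H : Fin (size G) → Graph) k Kind
  (F F′ : (K : Graph) → Fin (size K) → Subset (size K)) →
  (∀ K x v → F K x v ≡ true → F′ (complement K) x v ≡ true) →
  PropertyShape G H k Kind F → PropertyShape G (complement ∘ H) k Kind F′
PropertyShape-complement G H k Kind F F′ F⊆F′ property c kind with property c kind
... | A , bases , bound = A , (λ j cj → basis-complement (H j) k (A j) (bases j cj)) ,
  λ j l cj cl j≢l x y → ≤-trans (bound j l cj cl j≢l x y)
    (+-mono-≤ (count-mono _ _ λ v → ∧-monoʳ (F⊆F′ (H j) x v))
              (count-mono _ _ λ v → ∧-monoʳ (F⊆F′ (H l) y v)))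

lex-dim≡sum-adim : (G : Graph) → IsSimple G → Connected G → 2 ≤ size G →
  (H : Fin (size G) → Graph) → (∀ i → IsSimple (H i)) → (∀ i → 2 ≤ size (H i)) →
  (k : ℕ) (a : Fin (size G) → ℕ) → (∀ i → IsAdimK (H i) k (a i)) →
  P₁ G H k → P₂ G H k → IsDimK (lex G H) k (sumF a)
lex-dim≡sum-adim G simpleG connected twoG H simpleH twoH k a adim p₁ p₂ =
  (union , metricGen , |union|) , dim-lowerBound k a adim
  where
    open Lex G H simpleG
    open LowerBound connected twoG twoH
    open ClassBases G simpleG H k nonNbr closedNbr p₁ p₂ (λ j → adim⇒basis (H j) k (a j) (adim j))
    open UpperBound k B

    adjGen : IsKAdjGen X k union
    adjGen = union-adjGen (proj₁ ∘ B-isBasis)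
      (λ i → adjGen⇒k≤count (H i) k (B i) (twoH i) (proj₁ (B-isBasis i)))
      (B-twinPairBound {F = nonNbr} basisOfClass-trueTwins) (B-twinPairBound {F = closedNbr} basisOfClass-falseTwins)

    metricGen : IsKMetricGen X k union
    metricGen = adjGen⇒metricGen X (lex-loopless (proj₂ ∘ simpleH)) two k union adjGen

    |union| : count union ≡ sumF a
    |union| = trans count-union (sumF-cong _ _ λ i → basis-count (H i) k (a i) (B i) (adim i) (B-isBasis i))

-- In the paper 1 ≤ k, k ≤ 𝒯 and k ≤ 𝒞 only ensure that the dimensions involved are defined; here the
-- hypothesis on a already supplies k-adjacency bases, from which a k-metric generator is built.
theorem13 : (G : Graph) → IsSimple G → Connected G → 2 ≤ size G →
    (H : Fin (size G) → Graph) →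
    (∀ i → IsSimple (H i)) → (∀ i → 2 ≤ size (H i)) →
    (k : ℕ) → 1 ≤ k → LeT k G H → (∀ i → LeC k (H i)) →
    (a : Fin (size G) → ℕ) → (∀ i → IsAdimK (H i) k (a i)) →
      (P₁ G H k → P₂ G H k → IsDimK (lex G H) k (sumF a))
    × (P₃ G H k → P₄ G H k →
         IsDimK (lex G (λ i → complement (H i))) k (sumF a))
theorem13 G simpleG connected twoG H simpleH twoH k _ _ _ a adim =
  lex-dim≡sum-adim G simpleG connected twoG H simpleH twoH k a adim ,
  λ p₃ p₄ → lex-dim≡sum-adim G simpleG connected twoG
    (complement ∘ H) (λ i → complement-simple (H i) (simpleH i)) twoH k a
    (λ i → adim-complement (H i) k (a i) (adim i))
    (PropertyShape-complement G H k (InTT G) openNbr nonNbr openNbr⇒complement-nonNbr p₃)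
    (PropertyShape-complement G H k (InFT G) nonNbr closedNbr nonNbr⇒complement-closedNbr p₄)
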